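{- Let $k\ge 1$ and let $P\subseteq\{1,2,3\}^k$ be a puzzle. Then $P$ is a strong uniquely solvable puzzle if and only if the tripartite 3-hypergraph $H_P$ has no non-trivial 3D matching.
   Context: A puzzle of width $k$ is a finite set $P\subseteq\{1,2,3\}^k$; its elements are called rows, and $|P|=s$ is its size (an $(s,k)$-puzzle). For $r\in P$ and $c\in\{1,\dots,k\}$, $r_c$ denotes the $c$-th coordinate. $\mathrm{Sym}(P)$ is the group of permutations of $P$. A puzzle $P$ is a strong uniquely solvable puzzle (strong USP, SUSP) if for all $\pi_1,\pi_2,\pi_3\in\mathrm{Sym}(P)$, either (i) $\pi_1=\pi_2=\pi_3$, or (ii) there exist $r\in P$ and $c\in\{1,\dots,k\}$ such that exactly two of the following hold: $(\pi_1(r))_c=1$, $(\pi_2(r))_c=2$, $(\pi_3(r))_c=3$. For $a,b,c\in P$ let $f_P(a,b,c)=1$ if there exists a column $i$ such that exactly two of $a_i=1$, $b_i=2$, $c_i=3$ hold, and $f_P(a,b,c)=0$ otherwise. $H_P$ is the tripartite 3-hypergraph whose vertex set is the disjoint union of three copies of $P$ and whose edge set is $\{(a,b,c)\in P^3: f_P(a,b,c)=0\}$. A 3D matching of $H_P$ is a set $M$ of edges with $|M|=|P|$ whose edges are pairwise vertex disjoint (in each of the three coordinates). It is non-trivial if $M\neq\{(r,r,r): r\in P\}$. -}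

module Defs where

open import Data.Nat using (ℕ)
open import Data.Bool using (Bool; true; false; T)
open import Data.Fin using (Fin)
open import Data.Sum using (_⊎_)
open import Data.Vec using (Vec; lookup)
open import Data.List using (List; length; map; allFin)
open import Data.List.Membership.Propositional using (_∈_)
open import Data.List.Relation.Unary.All using (All)
open import Data.List.Relation.Unary.AllPairs using (AllPairs)
open import Data.Product using (_×_; _,_; ∃; ∃-syntax; proj₁; proj₂)
open import Data.Fin.Permutation using (Permutation′; _⟨$⟩ʳ_; _≈_)
open import Function.Definitions using (Injective)
open import Function.Bundles using (_⇔_)
open import Relation.Binary.PropositionalEquality using (_≡_; _≢_)
open import Relation.Nullary using (¬_)

data Entry : Set where
  one two three : Entry

Row : ℕ → Set
Row k = Vec Entry k

-- A puzzle of width k and size s: a finite set of s distinct rows,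
-- given by an injective enumeration P : Fin s → Row k.
-- Row P i is "the row indexed by i"; Sym(P) corresponds to Permutation′ s.
IsPuzzle : ∀ {k s} → (Fin s → Row k) → Set
IsPuzzle P = Injective _≡_ _≡_ P

is1 is2 is3 : Entry → Bool
is1 one = true
is1 _   = false
is2 two = true
is2 _   = false
is3 three = true
is3 _     = false

exactlyTwo : Bool → Bool → Bool → Bool
exactlyTwo true  true  false = true
exactlyTwo true  false true  = true
exactlyTwo false true  true  = true
exactlyTwo _     _     _     = false

ColWitness : ∀ {k} → Row k → Row k → Row k → Fin k → Set
ColWitness a b d c =
  T (exactlyTwo (is1 (lookup a c)) (is2 (lookup b c)) (is3 (lookup d c)))

fP≡1 : ∀ {k} → Row k → Row k → Row k → Set
fP≡1 a b d = ∃[ c ] ColWitness a b d c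

IsSUSP : ∀ {k s} → (Fin s → Row k) → Set
IsSUSP {k} {s} P =
  (π₁ π₂ π₃ : Permutation′ s) →
    ((π₁ ≈ π₂) × (π₂ ≈ π₃))
    ⊎ (∃[ r ] ∃[ c ] ColWitness (P (π₁ ⟨$⟩ʳ r)) (P (π₂ ⟨$⟩ʳ r)) (P (π₃ ⟨$⟩ʳ r)) c)

-- Vertices of each part of H_P are the rows of P, indexed by Fin s.
Triple : ℕ → Set
Triple s = Fin s × Fin s × Fin s

IsEdge : ∀ {k s} → (Fin s → Row k) → Triple s → Set
IsEdge P (a , b , d) = ¬ fP≡1 (P a) (P b) (P d)

Disjoint : ∀ {s} → Triple s → Triple s → Set
Disjoint (a , b , d) (a′ , b′ , d′) = (a ≢ a′) × (b ≢ b′) × (d ≢ d′)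

trivialM : (s : ℕ) → List (Triple s)
trivialM s = map (λ i → i , i , i) (allFin s)

-- A 3D matching of H_P: a set M of edges (listed without repetition,
-- which pairwise disjointness forces) with |M| = |P|, pairwise vertex disjoint.
Is3DMatching : ∀ {k s} → (Fin s → Row k) → List (Triple s) → Set
Is3DMatching {s = s} P M =
  (length M ≡ s) × All (IsEdge P) M × AllPairs Disjoint M

NonTrivial : ∀ {s} → List (Triple s) → Set
NonTrivial {s} M = ¬ (∀ t → (t ∈ M) ⇔ (t ∈ trivialM s))

{-# OPTIONS --safe #-}
module Submission where

-- A triple of permutations (π₁, π₂, π₃) of the rows gives the perfect
-- matching {(π₁ r, π₂ r, π₃ r)} of the complete tripartite hypergraph on
-- three copies of P, and every perfect matching arises this way: its three
-- coordinate maps are injective maps between sets of size |P|, hence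
-- bijections.  Under this correspondence, the strong USP condition failing
-- for (π₁, π₂, π₃) says exactly that every triple of the matching is an edge
-- of H_P, and the matching is the trivial one exactly when π₁ = π₂ = π₃.

open import Defs
open import Level using (Level)
open import Data.Nat using (ℕ; _≤_; suc)
open import Data.Nat.Properties using (1+n≰n)
open import Data.Fin using (Fin; punchOut)
open import Data.Fin.Properties using (_≟_; any?; all?; punchOut-injective; injective⇒≤)
open import Data.Fin.Permutation
  using (Permutation; Permutation′; permutation; _⟨$⟩ʳ_; _⟨$⟩ˡ_; _≈_; _∘ₚ_; cast-id; inverseʳ)
open import Data.List using (List; length; lookup; map; allFin)
open import Data.List.Properties using (length-map; length-tabulate)
open import Data.List.Membership.Propositional using (_∈_)
open import Data.List.Membership.Propositional.Properties using (∈-lookup; ∈-map⁺; ∈-map⁻; ∈-allFin)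
open import Data.List.Relation.Unary.Any using (index)
open import Data.List.Relation.Unary.Any.Properties using (lookup-index)
open import Data.List.Relation.Unary.All as All using (All)
open import Data.List.Relation.Unary.AllPairs as AllPairs using (AllPairs; _∷_)
open import Data.List.Relation.Unary.AllPairs.Properties using (map⁺)
open import Data.List.Relation.Unary.Unique.Propositional.Properties using (allFin⁺)
open import Data.Product using (_×_; _,_; ∃; ∃-syntax; proj₁; proj₂)
open import Data.Sum using (inj₁; inj₂)
open import Data.Bool.Properties using (T?)
open import Function using (_∘_; _on_)
open import Function.Bundles using (_⇔_; mk⇔; Equivalence; Injection)
open import Function.Properties.Inverse using (↔⇒↣)
open import Function.Definitions using (Injective)
open import Relation.Nullary using (¬_; Dec; yes; no; contradiction)
open import Relation.Nullary.Decidable using (_×-dec_)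
open import Relation.Binary.PropositionalEquality using (_≡_; _≢_; refl; sym; trans; cong; subst)

private variable
  a b p : Level
  A : Set a
  B : Set b
  k m n s : ℕ

injective⇒surjective : {f : Fin m → Fin n} → m ≡ n → Injective _≡_ _≡_ f →
                       ∀ y → ∃ λ x → f x ≡ y
injective⇒surjective {n = suc n} {f} refl f-injective y with any? (λ x → f x ≟ y)
... | yes hit = hit
... | no miss = contradiction (injective⇒≤ missed-injective) 1+n≰n
  where
  misses : ∀ x → y ≢ f x
  misses x y≡fx = miss (x , sym y≡fx)

  missed : Fin (suc n) → Fin n
  missed x = punchOut (misses x)

  missed-injective : Injective _≡_ _≡_ missed
  missed-injective {x} {x′} eq = f-injective (punchOut-injective (misses x) (misses x′) eq)

injective⇒permutation : (f : Fin m → Fin n) → Injective _≡_ _≡_ f → m ≡ n → Permutation m n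
injective⇒permutation f f-injective m≡n =
  permutation f (proj₁ ∘ surjective) (proj₂ ∘ surjective)
    (λ x → f-injective (proj₂ (surjective (f x))))
  where
  surjective : ∀ y → ∃ λ x → f x ≡ y
  surjective = injective⇒surjective m≡n f-injective

distinct⇒lookup-injective : {f : A → B} {xs : List A} →
                            AllPairs (_≢_ on f) xs → Injective _≡_ _≡_ (f ∘ lookup xs)
distinct⇒lookup-injective (_ ∷ _) {Fin.zero} {Fin.zero} _ = refl
distinct⇒lookup-injective (fx≢ ∷ _) {Fin.zero} {Fin.suc j} eq =
  contradiction eq (All.lookup fx≢ (∈-lookup j))
distinct⇒lookup-injective (fx≢ ∷ _) {Fin.suc i} {Fin.zero} eq =
  contradiction (sym eq) (All.lookup fx≢ (∈-lookup i))
distinct⇒lookup-injective (_ ∷ distinct) {Fin.suc i} {Fin.suc j} eq =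
  cong Fin.suc (distinct⇒lookup-injective distinct eq)

Enumerates : {A : Set a} → (Fin n → A) → List A → Set a
Enumerates e xs = ∀ x → x ∈ xs ⇔ ∃ λ j → e j ≡ x

map-allFin-enumerates : (e : Fin n → A) → Enumerates e (map e (allFin n))
map-allFin-enumerates e x = mk⇔ to from
  where
  to : x ∈ map e (allFin _) → ∃ λ j → e j ≡ x
  to x∈ with j , _ , x≡ej ← ∈-map⁻ e x∈ = j , sym x≡ej

  from : (∃ λ j → e j ≡ x) → x ∈ map e (allFin _)
  from (j , refl) = ∈-map⁺ e (∈-allFin j)

lookup-permutation-enumerates : {xs : List A} (ρ : Permutation n (length xs)) →
                                Enumerates (lookup xs ∘ (ρ ⟨$⟩ʳ_)) xs
lookup-permutation-enumerates {xs = xs} ρ x = mk⇔ to from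
  where
  to : x ∈ xs → ∃ λ j → lookup xs (ρ ⟨$⟩ʳ j) ≡ x
  to x∈ = ρ ⟨$⟩ˡ index x∈ , trans (cong (lookup xs) (inverseʳ ρ)) (sym (lookup-index x∈))

  from : (∃ λ j → lookup xs (ρ ⟨$⟩ʳ j) ≡ x) → x ∈ xs
  from (j , refl) = ∈-lookup (ρ ⟨$⟩ʳ j)

enumerates-All : {P : A → Set p} {e : Fin n → A} {xs : List A} →
                 Enumerates e xs → (∀ j → P (e j)) → All P xs
enumerates-All {P = P} enumerates Pe = All.tabulate λ {x} x∈ →
  let j , ej≡x = Equivalence.to (enumerates x) x∈ in subst P ej≡x (Pe j)

triples : (π₁ π₂ π₃ : Permutation′ s) → Fin s → Triple s
triples π₁ π₂ π₃ r = π₁ ⟨$⟩ʳ r , π₂ ⟨$⟩ʳ r , π₃ ⟨$⟩ʳ r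

diagonal : Fin s → Triple s
diagonal i = i , i , i

diagonal-components : ∀ {i x y z : Fin s} → diagonal i ≡ (x , y , z) → x ≡ y × y ≡ z
diagonal-components refl = refl , refl

module _ (π₁ π₂ π₃ : Permutation′ s) where

  triples≡diagonal : π₁ ≈ π₂ → π₂ ≈ π₃ → ∀ r → triples π₁ π₂ π₃ r ≡ diagonal (π₁ ⟨$⟩ʳ r)
  triples≡diagonal π₁≈π₂ π₂≈π₃ r rewrite π₁≈π₂ r | π₂≈π₃ r = refl

  enumerates-trivial⇔≈ : {M : List (Triple s)} → Enumerates (triples π₁ π₂ π₃) M →
                         (∀ t → t ∈ M ⇔ t ∈ trivialM s) ⇔ (π₁ ≈ π₂ × π₂ ≈ π₃)
  enumerates-trivial⇔≈ {M} enumerates = mk⇔ trivial⇒equal equal⇒trivial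
    where
    trivial-enumerates : Enumerates diagonal (trivialM s)
    trivial-enumerates = map-allFin-enumerates diagonal

    diagonal-row : (∀ t → t ∈ M ⇔ t ∈ trivialM s) → ∀ r →
                   π₁ ⟨$⟩ʳ r ≡ π₂ ⟨$⟩ʳ r × π₂ ⟨$⟩ʳ r ≡ π₃ ⟨$⟩ʳ r
    diagonal-row same r =
      let t = triples π₁ π₂ π₃ r
          t∈M = Equivalence.from (enumerates t) (r , refl)
          _ , diagonal≡t = Equivalence.to (trivial-enumerates t) (Equivalence.to (same t) t∈M)
      in diagonal-components diagonal≡t

    trivial⇒equal : (∀ t → t ∈ M ⇔ t ∈ trivialM s) → π₁ ≈ π₂ × π₂ ≈ π₃
    trivial⇒equal same = proj₁ ∘ diagonal-row same , proj₂ ∘ diagonal-row same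

    equal⇒trivial : π₁ ≈ π₂ × π₂ ≈ π₃ → ∀ t → t ∈ M ⇔ t ∈ trivialM s
    equal⇒trivial (π₁≈π₂ , π₂≈π₃) t = mk⇔
      (Equivalence.from (trivial-enumerates t) ∘ to-diagonal ∘ Equivalence.to (enumerates t))
      (Equivalence.from (enumerates t) ∘ from-diagonal ∘ Equivalence.to (trivial-enumerates t))
      where
      on-diagonal : ∀ r → triples π₁ π₂ π₃ r ≡ diagonal (π₁ ⟨$⟩ʳ r)
      on-diagonal = triples≡diagonal π₁≈π₂ π₂≈π₃

      to-diagonal : (∃ λ r → triples π₁ π₂ π₃ r ≡ t) → ∃ λ i → diagonal i ≡ t
      to-diagonal (r , eq) = π₁ ⟨$⟩ʳ r , trans (sym (on-diagonal r)) eq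

      from-diagonal : (∃ λ i → diagonal i ≡ t) → ∃ λ r → triples π₁ π₂ π₃ r ≡ t
      from-diagonal (i , eq) =
        π₁ ⟨$⟩ˡ i , trans (on-diagonal (π₁ ⟨$⟩ˡ i)) (trans (cong diagonal (inverseʳ π₁)) eq)

disjoint⇒enumerated-by-permutations :
  {M : List (Triple s)} → length M ≡ s → AllPairs Disjoint M →
  ∃[ π₁ ] ∃[ π₂ ] ∃[ π₃ ] Enumerates (triples π₁ π₂ π₃) M
disjoint⇒enumerated-by-permutations {s = s} {M} |M|≡s disjoint =
    ρ ∘ₚ coordinate proj₁ (AllPairs.map proj₁ disjoint)
  , ρ ∘ₚ coordinate (proj₁ ∘ proj₂) (AllPairs.map (proj₁ ∘ proj₂) disjoint)
  , ρ ∘ₚ coordinate (proj₂ ∘ proj₂) (AllPairs.map (proj₂ ∘ proj₂) disjoint)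
  , lookup-permutation-enumerates ρ
  where
  ρ : Permutation s (length M)
  ρ = cast-id (sym |M|≡s)

  coordinate : (f : Triple s → Fin s) → AllPairs (_≢_ on f) M → Permutation (length M) s
  coordinate f distinct =
    injective⇒permutation (f ∘ lookup M) (distinct⇒lookup-injective distinct) |M|≡s

fP≡1? : (x y z : Row k) → Dec (fP≡1 x y z)
fP≡1? x y z = any? λ c → T? _

≈? : (π ρ : Permutation′ s) → Dec (π ≈ ρ)
≈? π ρ = all? λ i → π ⟨$⟩ʳ i ≟ ρ ⟨$⟩ʳ i

module _ (P : Fin s → Row k) where

  permutation-matching : (π₁ π₂ π₃ : Permutation′ s) → (∀ r → IsEdge P (triples π₁ π₂ π₃ r)) →
                         Is3DMatching P (map (triples π₁ π₂ π₃) (allFin s))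
  permutation-matching π₁ π₂ π₃ edges =
      trans (length-map _ (allFin s)) (length-tabulate _)
    , enumerates-All (map-allFin-enumerates _) edges
    , map⁺ (AllPairs.map (λ i≢j → i≢j ∘ injective π₁ , i≢j ∘ injective π₂ , i≢j ∘ injective π₃)
                        (allFin⁺ s))
    where
    injective : (π : Permutation′ s) → Injective _≡_ _≡_ (π ⟨$⟩ʳ_)
    injective = Injection.injective ∘ ↔⇒↣

  SUSP⇒no-nontrivial-matching : IsSUSP P → ¬ (∃[ M ] (Is3DMatching P M × NonTrivial M))
  SUSP⇒no-nontrivial-matching susp (M , (|M|≡s , edges , disjoint) , nontrivial)
    with π₁ , π₂ , π₃ , enumerates ← disjoint⇒enumerated-by-permutations |M|≡s disjoint
    with susp π₁ π₂ π₃
  ... | inj₁ equal = nontrivial (Equivalence.from (enumerates-trivial⇔≈ π₁ π₂ π₃ enumerates) equal)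
  ... | inj₂ (r , witness) = All.lookup edges (Equivalence.from (enumerates _) (r , refl)) witness

  no-nontrivial-matching⇒SUSP : ¬ (∃[ M ] (Is3DMatching P M × NonTrivial M)) → IsSUSP P
  no-nontrivial-matching⇒SUSP no-matching π₁ π₂ π₃
    with ≈? π₁ π₂ ×-dec ≈? π₂ π₃
       | any? (λ r → fP≡1? (P (π₁ ⟨$⟩ʳ r)) (P (π₂ ⟨$⟩ʳ r)) (P (π₃ ⟨$⟩ʳ r)))
  ... | yes equal  | _              = inj₁ equal
  ... | no _       | yes witness    = inj₂ witness
  ... | no unequal | no no-witness  = contradiction
    ( map (triples π₁ π₂ π₃) (allFin s)
    , permutation-matching π₁ π₂ π₃ (λ r witness → no-witness (r , witness))
    , unequal ∘ Equivalence.to (enumerates-trivial⇔≈ π₁ π₂ π₃ (map-allFin-enumerates _)))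
    no-matching

lemma4 : ∀ {k s : ℕ} → 1 ≤ k → (P : Fin s → Row k) → IsPuzzle P →
    IsSUSP P ⇔ (¬ (∃[ M ] (Is3DMatching P M × NonTrivial M)))
lemma4 _ P _ = mk⇔ (SUSP⇒no-nontrivial-matching P) (no-nontrivial-matching⇒SUSP P)
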